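{- Let $q$ be a prime power and let $N_1,N_2$ be positive integers with $N_1\ge N_2$. Let $\nu(N_1,N_2)$ denote the number of ordered pairs $(f_1,f_2)$ of coprime nonzero polynomials in $\mathbb{F}_q[X]$ with $f_2$ monic and $\deg f_i<N_i$ for $i=1,2$. Then $\nu(N_1,N_2)=q^{N_1+N_2-1}-1$.
   Context: $\mathbb{F}_q$ denotes the finite field with $q$ elements. -}

module Defs where

open import Level using (Level; _⊔_)
open import Data.Nat as ℕ using (ℕ; zero; suc; _≤_; _<_)
open import Data.Nat.Primality using (Prime)
open import Data.Fin using (Fin)
open import Data.List using (List; []; _∷_)
open import Data.Product using (Σ; ∃; _×_; _,_)
open import Relation.Nullary using (¬_)
open import Relation.Binary.PropositionalEquality using (_≡_)
open import Relation.Binary using (Decidable)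
open import Algebra.Bundles using (CommutativeRing)

IsPrimePower : ℕ → Set
IsPrimePower q = Σ ℕ λ p → Σ ℕ λ k → Prime p × 1 ≤ k × q ≡ p ℕ.^ k


-- A field: a commutative ring with 1 ≉ 0 in which every nonzero element
-- has a multiplicative inverse.  We also record decidable equality
-- (automatic for a finite field classically).
record Field c ℓ : Set (Level.suc (c ⊔ ℓ)) where
  field
    commRing : CommutativeRing c ℓ
  open CommutativeRing commRing public hiding (ring)
  field
    1≉0   : ¬ (1# ≈ 0#)
    inv   : ∀ x → ¬ (x ≈ 0#) → Σ Carrier λ y → (x * y) ≈ 1#
    _≟_   : Decidable _≈_

record HasCard {c ℓ} (F : Field c ℓ) (q : ℕ) : Set (c ⊔ ℓ) where
  open Field F
  field
    enum      : Fin q → Carrier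
    enum-inj  : ∀ i j → enum i ≈ enum j → i ≡ j
    enum-surj : ∀ x → Σ (Fin q) λ i → enum i ≈ x

record HasCount {a r p} {A : Set a} (_∼_ : A → A → Set r) (P : A → Set p)
                (n : ℕ) : Set (a ⊔ r ⊔ p) where
  field
    elem       : Fin n → A
    elem-P     : ∀ i → P (elem i)
    elem-inj   : ∀ i j → elem i ∼ elem j → i ≡ j
    elem-cover : ∀ x → P x → Σ (Fin n) λ i → elem i ∼ x

-- Polynomials over a field, as coefficient lists (constant term first).
module Poly {c ℓ} (F : Field c ℓ) where
  open Field F

  Pol : Set c
  Pol = List Carrier

  coeff : Pol → ℕ → Carrier
  coeff []       _       = 0#
  coeff (a ∷ f)  zero    = a
  coeff (a ∷ f)  (suc i) = coeff f i

  _≈ₚ_ : Pol → Pol → Set ℓ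
  f ≈ₚ g = ∀ i → coeff f i ≈ coeff g i

  scale : Carrier → Pol → Pol
  scale a []      = []
  scale a (b ∷ f) = (a * b) ∷ scale a f

  _+ₚ_ : Pol → Pol → Pol
  []      +ₚ g       = g
  (a ∷ f) +ₚ []      = a ∷ f
  (a ∷ f) +ₚ (b ∷ g) = (a + b) ∷ (f +ₚ g)

  _*ₚ_ : Pol → Pol → Pol
  []      *ₚ g = []
  (a ∷ f) *ₚ g = scale a g +ₚ (0# ∷ (f *ₚ g))

  1ₚ : Pol
  1ₚ = 1# ∷ []

  0ₚ : Pol
  0ₚ = []

  _∣ₚ_ : Pol → Pol → Set (c ⊔ ℓ)
  g ∣ₚ f = Σ Pol λ h → (g *ₚ h) ≈ₚ f

  Coprime : Pol → Pol → Set (c ⊔ ℓ)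
  Coprime f g = ∀ d → d ∣ₚ f → d ∣ₚ g → d ∣ₚ 1ₚ

  NonZero : Pol → Set ℓ
  NonZero f = ¬ (f ≈ₚ 0ₚ)

  DegLt : Pol → ℕ → Set ℓ
  DegLt f N = ∀ i → N ≤ i → coeff f i ≈ 0#

  Monic : Pol → Set ℓ
  Monic f = Σ ℕ λ d → coeff f d ≈ 1# × (∀ i → d < i → coeff f i ≈ 0#)

  _≈₂_ : Pol × Pol → Pol × Pol → Set ℓ
  (f₁ , f₂) ≈₂ (g₁ , g₂) = f₁ ≈ₚ g₁ × f₂ ≈ₚ g₂

  ν-Pair : ℕ → ℕ → Pol × Pol → Set (c ⊔ ℓ)
  ν-Pair N₁ N₂ (f₁ , f₂) =
    NonZero f₁ × NonZero f₂ × Coprime f₁ f₂ × Monic f₂ × DegLt f₁ N₁ × DegLt f₂ N₂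

-- Let A(e, j) be the number of coprime pairs (s, r) with deg s < j and r monic of degree e.  The pairs
-- with deg s = j are those with s = b s′, b ≠ 0 and s′ monic of degree j; dividing r by s′ as r = s′ a + t
-- (a monic of degree e − j, deg t < j, gcd(r, s′) = gcd(t, s′)) shows that there are (q − 1) q^(e − j) A(j, j)
-- of them.  Hence A(e, j + 1) = A(e, j) + (q − 1) q^(e − j) A(j, j), so A(e, j) = (q − 1) q^(e + j − 1) for
-- 1 ≤ j ≤ e.  Dividing f₁ by f₂ in the same way, the coprime pairs in which f₂ is monic of degree k < N₁ and
-- deg f₁ < N₁ number q^(N₁ − k) A(k, k); summing over k < N₂ gives q^(N₁ + N₂ − 1) pairs, among which (0, 1)
-- is the only one with f₁ = 0.
module Submission where

open import Defs
open import Level using (Level)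
import Data.Nat

module Counting where
  open import Data.Nat using (suc; _+_; _*_)
  open import Data.Fin using (Fin; zero; splitAt; join; _↑ˡ_; _↑ʳ_; combine; remQuot; punchIn; punchOut)
  open import Data.Fin.Properties
    using (splitAt-↑ˡ; splitAt-↑ʳ; join-splitAt; combine-remQuot; remQuot-combine;
           punchIn-injective; punchInᵢ≢i; punchIn-punchOut)
  open import Data.Product using (Σ; _×_; _,_; proj₁; proj₂)
  open import Data.Product.Relation.Binary.Pointwise.NonDependent using (Pointwise)
  open import Data.Sum using (_⊎_; inj₁; inj₂)
  open import Data.Empty using (⊥-elim)
  open import Function.Bundles using (_⇔_; Equivalence)
  open import Relation.Nullary using (¬_)
  open import Relation.Binary using (Rel; Setoid)
  open import Relation.Binary.PropositionalEquality as ≡ using (_≡_; refl; cong; cong₂)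

  private variable
    a b r s p p′ : Level
    A : Set a
    B : Set b

  module _ {_∼_ : Rel A r} {P : A → Set p} where

    HasCount-∅ : (∀ x → ¬ P x) → HasCount _∼_ P 0
    HasCount-∅ ¬P = record
      { elem = λ () ; elem-P = λ () ; elem-inj = λ () ; elem-cover = λ x Px → ⊥-elim (¬P x Px) }

    HasCount-singleton : (x₀ : A) → P x₀ → (∀ x → P x → x₀ ∼ x) → HasCount _∼_ P 1
    HasCount-singleton x₀ Px₀ unique = record
      { elem = λ _ → x₀ ; elem-P = λ _ → Px₀
      ; elem-inj = λ { zero zero _ → refl } ; elem-cover = λ x Px → zero , unique x Px }

    HasCount-resp-≡ : ∀ {m n} → m ≡ n → HasCount _∼_ P m → HasCount _∼_ P n
    HasCount-resp-≡ refl C = C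

    HasCount-⇔ : ∀ {n} {_≈_ : Rel A s} {Q : A → Set p′} →
      (∀ {x y} → x ∼ y → x ≈ y) → (∀ {x y} → x ≈ y → x ∼ y) → (∀ x → P x ⇔ Q x) → HasCount _∼_ P n → HasCount _≈_ Q n
    HasCount-⇔ ∼⇒≈ ≈⇒∼ P⇔Q C = record
      { elem       = elem
      ; elem-P     = λ i → Equivalence.to (P⇔Q _) (elem-P i)
      ; elem-inj   = λ i j e → elem-inj i j (≈⇒∼ e)
      ; elem-cover = λ x Qx → let (i , e) = elem-cover x (Equivalence.from (P⇔Q x) Qx) in i , ∼⇒≈ e }
      where open HasCount C

  module _ {_∼_ : Rel A r} (S : Setoid b s) where
    open Setoid S using (_≈_; trans) renaming (Carrier to C)

    HasCount-map : ∀ {n} {P : A → Set p} {Q : C → Set p′} (φ : A → C) →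
      (∀ x y → x ∼ y → φ x ≈ φ y) →
      (∀ x → P x → Q (φ x)) →
      (∀ x y → P x → P y → φ x ≈ φ y → x ∼ y) →
      (∀ y → Q y → Σ A λ x → P x × φ x ≈ y) →
      HasCount _∼_ P n → HasCount _≈_ Q n
    HasCount-map φ φ-cong φ-P φ-inj φ-surj C = record
      { elem       = λ i → φ (elem i)
      ; elem-P     = λ i → φ-P _ (elem-P i)
      ; elem-inj   = λ i j e → elem-inj i j (φ-inj _ _ (elem-P i) (elem-P j) e)
      ; elem-cover = λ y Qy →
          let (x , Px , φx≈y) = φ-surj y Qy ; (i , eᵢ≈x) = elem-cover x Px
          in  i , trans (φ-cong _ _ eᵢ≈x) φx≈y }
      where open HasCount C

  module _ (S : Setoid a r) where
    open Setoid S using (_≈_; sym; trans) renaming (Carrier to C)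

    HasCount-⊎ : ∀ {m n} {P Q R : C → Set p} → HasCount _≈_ P m → HasCount _≈_ Q n →
      (∀ x → R x → P x ⊎ Q x) → (∀ x → P x → R x) → (∀ x → Q x → R x) →
      (∀ x y → P x → Q y → ¬ x ≈ y) → HasCount _≈_ R (m + n)
    HasCount-⊎ {m = m} {n} {R = R} CP CQ split P⇒R Q⇒R disjoint = record
      { elem = λ k → elem⊎ (splitAt m k)
      ; elem-P = λ k → elem⊎-R (splitAt m k)
      ; elem-inj = λ k l e → ≡.trans (≡.sym (join-splitAt m n k))
          (≡.trans (cong (join m n) (elem⊎-inj (splitAt m k) (splitAt m l) e)) (join-splitAt m n l))
      ; elem-cover = cover }
      where
      module CP = HasCount CP
      module CQ = HasCount CQ
      elem⊎ : Fin m ⊎ Fin n → C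
      elem⊎ (inj₁ i) = CP.elem i
      elem⊎ (inj₂ j) = CQ.elem j
      elem⊎-R : ∀ u → R (elem⊎ u)
      elem⊎-R (inj₁ i) = P⇒R _ (CP.elem-P i)
      elem⊎-R (inj₂ j) = Q⇒R _ (CQ.elem-P j)
      elem⊎-inj : ∀ u v → elem⊎ u ≈ elem⊎ v → u ≡ v
      elem⊎-inj (inj₁ i) (inj₁ j) e = cong inj₁ (CP.elem-inj i j e)
      elem⊎-inj (inj₁ i) (inj₂ j) e = ⊥-elim (disjoint _ _ (CP.elem-P i) (CQ.elem-P j) e)
      elem⊎-inj (inj₂ i) (inj₁ j) e = ⊥-elim (disjoint _ _ (CP.elem-P j) (CQ.elem-P i) (sym e))
      elem⊎-inj (inj₂ i) (inj₂ j) e = cong inj₂ (CQ.elem-inj i j e)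
      cover : ∀ x → R x → Σ (Fin (m + n)) λ k → elem⊎ (splitAt m k) ≈ x
      cover x Rx with split x Rx
      ... | inj₁ Px = let (i , e) = CP.elem-cover x Px
                      in  i ↑ˡ n , ≡.subst (λ u → elem⊎ u ≈ x) (≡.sym (splitAt-↑ˡ m i n)) e
      ... | inj₂ Qx = let (j , e) = CQ.elem-cover x Qx
                      in  m ↑ʳ j , ≡.subst (λ u → elem⊎ u ≈ x) (≡.sym (splitAt-↑ʳ m n j)) e

    HasCount-remove : ∀ {n} {P : C → Set p} → HasCount _≈_ P (suc n) →
      (x₀ : C) → P x₀ → HasCount _≈_ (λ x → P x × ¬ x ≈ x₀) n
    HasCount-remove {n = n} {P} C x₀ Px₀ = record
      { elem = λ k → elem (punchIn i₀ k)
      ; elem-P = λ k → elem-P _ , λ e → punchInᵢ≢i i₀ k (elem-inj _ _ (trans e (sym eᵢ₀≈x₀)))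
      ; elem-inj = λ k l e → punchIn-injective i₀ k l (elem-inj _ _ e)
      ; elem-cover = cover }
      where
      open HasCount C
      i₀ = proj₁ (elem-cover x₀ Px₀)
      eᵢ₀≈x₀ = proj₂ (elem-cover x₀ Px₀)
      cover : ∀ x → P x × ¬ x ≈ x₀ → Σ (Fin n) λ k → elem (punchIn i₀ k) ≈ x
      cover x (Px , x≉x₀) with elem-cover x Px
      ... | j , eⱼ≈x = punchOut i₀≢j , ≡.subst (λ u → elem u ≈ x) (≡.sym (punchIn-punchOut i₀≢j)) eⱼ≈x
        where
        i₀≢j : ¬ i₀ ≡ j
        i₀≢j refl = x≉x₀ (trans (sym eⱼ≈x) eᵢ₀≈x₀)

  HasCount-× : ∀ {m n} {_∼A_ : Rel A r} {_∼B_ : Rel B s} {P : A → Set p} {Q : B → Set p′} →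
    HasCount _∼A_ P m → HasCount _∼B_ Q n →
    HasCount (Pointwise _∼A_ _∼B_) (λ (x , y) → P x × Q y) (m * n)
  HasCount-× {A = A} {B = B} {m = m} {n} {_∼A_} {_∼B_} CP CQ = record
    { elem = λ k → pair (remQuot n k)
    ; elem-P = λ k → CP.elem-P _ , CQ.elem-P _
    ; elem-inj = λ k l (e₁ , e₂) → ≡.trans (≡.sym (combine-remQuot {m} n k))
        (≡.trans (cong₂ combine (CP.elem-inj _ _ e₁) (CQ.elem-inj _ _ e₂)) (combine-remQuot {m} n l))
    ; elem-cover = λ (x , y) (Px , Qy) →
        let (i , e₁) = CP.elem-cover x Px ; (j , e₂) = CQ.elem-cover y Qy
        in  combine i j , ≡.subst (λ u → Pointwise _∼A_ _∼B_ (pair u) (x , y)) (≡.sym (remQuot-combine i j)) (e₁ , e₂) }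
    where
    module CP = HasCount CP
    module CQ = HasCount CQ
    pair : Fin m × Fin n → A × B
    pair (i , j) = CP.elem i , CQ.elem j

module PolynomialRing {c ℓ} (F : Field c ℓ) where
  open import Data.Nat using (zero; suc)
  open import Data.List using ([]; _∷_)
  open import Relation.Binary using (Setoid; IsEquivalence)
  import Relation.Binary.Reasoning.Setoid
  open Field F hiding (zero)
  open Poly F
  open import Algebra.Properties.CommutativeSemigroup +-commutativeSemigroup
    using (interchange) renaming (x∙yz≈y∙xz to x+[y+z]≈y+[x+z])
  open import Algebra.Properties.CommutativeSemigroup *-commutativeSemigroup
    using () renaming (x∙yz≈y∙xz to x*[y*z]≈y*[x*z])
  module ≈-Reasoning = Relation.Binary.Reasoning.Setoid setoid

  -- A record rather than Defs' _≈ₚ_, so that f and g can be inferred from a proof of f ≋ g.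
  infix 4 _≋_
  record _≋_ (f g : Pol) : Set ℓ where
    constructor mk≋
    field coeff-≈ : ∀ i → coeff f i ≈ coeff g i
  open _≋_ public

  ≋-isEquivalence : IsEquivalence _≋_
  ≋-isEquivalence = record
    { refl  = mk≋ λ _ → refl
    ; sym   = λ f≋g → mk≋ λ i → sym (coeff-≈ f≋g i)
    ; trans = λ f≋g g≋h → mk≋ λ i → trans (coeff-≈ f≋g i) (coeff-≈ g≋h i) }

  ≋-setoid : Setoid c ℓ
  ≋-setoid = record { isEquivalence = ≋-isEquivalence }

  open IsEquivalence ≋-isEquivalence public using () renaming (refl to ≋-refl; sym to ≋-sym; trans to ≋-trans)
  module ≋-Reasoning = Relation.Binary.Reasoning.Setoid ≋-setoid

  ∷-cong : ∀ {a b f g} → a ≈ b → f ≋ g → (a ∷ f) ≋ (b ∷ g)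
  ∷-cong a≈b f≋g = mk≋ λ { zero → a≈b ; (suc i) → coeff-≈ f≋g i }

  ∷-≋[] : ∀ {a f} → a ≈ 0# → f ≋ [] → (a ∷ f) ≋ []
  ∷-≋[] a≈0 f≋[] = mk≋ λ { zero → a≈0 ; (suc i) → coeff-≈ f≋[] i }

  coeff-+ₚ : ∀ f g i → coeff (f +ₚ g) i ≈ coeff f i + coeff g i
  coeff-+ₚ []      g       i       = sym (+-identityˡ _)
  coeff-+ₚ (a ∷ f) []      i       = sym (+-identityʳ _)
  coeff-+ₚ (a ∷ f) (b ∷ g) zero    = refl
  coeff-+ₚ (a ∷ f) (b ∷ g) (suc i) = coeff-+ₚ f g i

  coeff-scale : ∀ a f i → coeff (scale a f) i ≈ a * coeff f i
  coeff-scale a []      i       = sym (zeroʳ a)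
  coeff-scale a (b ∷ f) zero    = refl
  coeff-scale a (b ∷ f) (suc i) = coeff-scale a f i

  +ₚ-pointwise : ∀ f g {h} → (∀ i → coeff f i + coeff g i ≈ coeff h i) → (f +ₚ g) ≋ h
  +ₚ-pointwise f g e = mk≋ λ i → trans (coeff-+ₚ f g i) (e i)

  +ₚ-cong : ∀ {f f′ g g′} → f ≋ f′ → g ≋ g′ → (f +ₚ g) ≋ (f′ +ₚ g′)
  +ₚ-cong {f} {f′} {g} {g′} f≋f′ g≋g′ = +ₚ-pointwise f g λ i →
    trans (+-cong (coeff-≈ f≋f′ i) (coeff-≈ g≋g′ i)) (sym (coeff-+ₚ f′ g′ i))

  +ₚ-identityʳ : ∀ f → (f +ₚ []) ≋ f
  +ₚ-identityʳ []      = ≋-refl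
  +ₚ-identityʳ (a ∷ f) = ≋-refl

  +ₚ-interchange : ∀ f g h k → ((f +ₚ g) +ₚ (h +ₚ k)) ≋ ((f +ₚ h) +ₚ (g +ₚ k))
  +ₚ-interchange f g h k = +ₚ-pointwise (f +ₚ g) (h +ₚ k) λ i → begin
    coeff (f +ₚ g) i + coeff (h +ₚ k) i                ≈⟨ +-cong (coeff-+ₚ f g i) (coeff-+ₚ h k i) ⟩
    (coeff f i + coeff g i) + (coeff h i + coeff k i)  ≈⟨ interchange _ _ _ _ ⟩
    (coeff f i + coeff h i) + (coeff g i + coeff k i)  ≈⟨ +-cong (coeff-+ₚ f h i) (coeff-+ₚ g k i) ⟨
    coeff (f +ₚ h) i + coeff (g +ₚ k) i                ≈⟨ coeff-+ₚ (f +ₚ h) (g +ₚ k) i ⟨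
    coeff ((f +ₚ h) +ₚ (g +ₚ k)) i                     ∎
    where open ≈-Reasoning

  +ₚ-leftComm : ∀ f g h → (f +ₚ (g +ₚ h)) ≋ (g +ₚ (f +ₚ h))
  +ₚ-leftComm f g h = +ₚ-pointwise f (g +ₚ h) λ i → begin
    coeff f i + coeff (g +ₚ h) i    ≈⟨ +-congˡ (coeff-+ₚ g h i) ⟩
    coeff f i + (coeff g i + coeff h i) ≈⟨ x+[y+z]≈y+[x+z] _ _ _ ⟩
    coeff g i + (coeff f i + coeff h i) ≈⟨ +-congˡ (coeff-+ₚ f h i) ⟨
    coeff g i + coeff (f +ₚ h) i    ≈⟨ coeff-+ₚ g (f +ₚ h) i ⟨
    coeff (g +ₚ (f +ₚ h)) i         ∎
    where open ≈-Reasoning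

  0∷-+ₚ : ∀ f g → (0# ∷ (f +ₚ g)) ≋ ((0# ∷ f) +ₚ (0# ∷ g))
  0∷-+ₚ f g = ∷-cong (sym (+-identityʳ 0#)) ≋-refl

  scale-cong : ∀ {a b f g} → a ≈ b → f ≋ g → scale a f ≋ scale b g
  scale-cong {a} {b} {f} {g} a≈b f≋g = mk≋ λ i →
    trans (coeff-scale a f i) (trans (*-cong a≈b (coeff-≈ f≋g i)) (sym (coeff-scale b g i)))

  scale-≈0 : ∀ {a} f → a ≈ 0# → scale a f ≋ []
  scale-≈0 []      a≈0 = ≋-refl
  scale-≈0 (b ∷ f) a≈0 = ∷-≋[] (trans (*-congʳ a≈0) (zeroˡ b)) (scale-≈0 f a≈0)

  scale-identity : ∀ f → scale 1# f ≋ f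
  scale-identity []      = ≋-refl
  scale-identity (b ∷ f) = ∷-cong (*-identityˡ b) (scale-identity f)

  scale-assoc : ∀ a b f → scale (a * b) f ≋ scale a (scale b f)
  scale-assoc a b []      = ≋-refl
  scale-assoc a b (c ∷ f) = ∷-cong (*-assoc a b c) (scale-assoc a b f)

  scale-comm : ∀ a b f → scale a (scale b f) ≋ scale b (scale a f)
  scale-comm a b []      = ≋-refl
  scale-comm a b (c ∷ f) = ∷-cong (x*[y*z]≈y*[x*z] a b c) (scale-comm a b f)

  scale-inverse : ∀ {u v} f → v * u ≈ 1# → scale v (scale u f) ≋ f
  scale-inverse {u} {v} f vu≈1 =
    ≋-trans (≋-sym (scale-assoc v u f)) (≋-trans (scale-cong vu≈1 ≋-refl) (scale-identity f))

  scale-distribˡ : ∀ a f g → scale a (f +ₚ g) ≋ (scale a f +ₚ scale a g)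
  scale-distribˡ a []      g       = ≋-refl
  scale-distribˡ a (b ∷ f) []      = ≋-refl
  scale-distribˡ a (b ∷ f) (c ∷ g) = ∷-cong (distribˡ a b c) (scale-distribˡ a f g)

  0∷-scale : ∀ a f → (0# ∷ scale a f) ≋ scale a (0# ∷ f)
  0∷-scale a f = ∷-cong (sym (zeroʳ a)) ≋-refl

  scale-distribʳ : ∀ a b f → scale (a + b) f ≋ (scale a f +ₚ scale b f)
  scale-distribʳ a b []      = ≋-refl
  scale-distribʳ a b (c ∷ f) = ∷-cong (distribʳ c a b) (scale-distribʳ a b f)

  *ₚ-zeroʳ : ∀ f → (f *ₚ []) ≋ []
  *ₚ-zeroʳ []      = ≋-refl
  *ₚ-zeroʳ (a ∷ f) = ∷-≋[] refl (*ₚ-zeroʳ f)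

  *ₚ-zeroˡ : ∀ {f} g → f ≋ [] → (f *ₚ g) ≋ []
  *ₚ-zeroˡ {[]}    g f≋[] = ≋-refl
  *ₚ-zeroˡ {a ∷ f} g f≋[] =
    +ₚ-cong (scale-≈0 g (coeff-≈ f≋[] 0)) (∷-≋[] refl (*ₚ-zeroˡ {f} g (mk≋ λ i → coeff-≈ f≋[] (suc i))))

  *ₚ-congʳ : ∀ f {g g′} → g ≋ g′ → (f *ₚ g) ≋ (f *ₚ g′)
  *ₚ-congʳ []      g≋g′ = ≋-refl
  *ₚ-congʳ (a ∷ f) g≋g′ = +ₚ-cong (scale-cong refl g≋g′) (∷-cong refl (*ₚ-congʳ f g≋g′))

  *ₚ-congˡ : ∀ {f f′} g → f ≋ f′ → (f *ₚ g) ≋ (f′ *ₚ g)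
  *ₚ-congˡ {[]}    {f′}     g f≋f′ = ≋-sym (*ₚ-zeroˡ g (≋-sym f≋f′))
  *ₚ-congˡ {a ∷ f} {[]}     g f≋f′ = *ₚ-zeroˡ g f≋f′
  *ₚ-congˡ {a ∷ f} {b ∷ f′} g f≋f′ =
    +ₚ-cong (scale-cong (coeff-≈ f≋f′ 0) ≋-refl)
            (∷-cong refl (*ₚ-congˡ {f} {f′} g (mk≋ λ i → coeff-≈ f≋f′ (suc i))))

  *ₚ-cong : ∀ {f f′ g g′} → f ≋ f′ → g ≋ g′ → (f *ₚ g) ≋ (f′ *ₚ g′)
  *ₚ-cong {f′ = f′} {g} f≋f′ g≋g′ = ≋-trans (*ₚ-congˡ g f≋f′) (*ₚ-congʳ f′ g≋g′)

  0∷-*ₚ : ∀ f g → ((0# ∷ f) *ₚ g) ≋ (0# ∷ (f *ₚ g))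
  0∷-*ₚ f g = +ₚ-cong (scale-≈0 g refl) ≋-refl

  *ₚ-distribˡ : ∀ f g h → (f *ₚ (g +ₚ h)) ≋ ((f *ₚ g) +ₚ (f *ₚ h))
  *ₚ-distribˡ []      g h = ≋-refl
  *ₚ-distribˡ (a ∷ f) g h = begin
    scale a (g +ₚ h) +ₚ (0# ∷ (f *ₚ (g +ₚ h)))
      ≈⟨ +ₚ-cong (scale-distribˡ a g h) (≋-trans (∷-cong refl (*ₚ-distribˡ f g h)) (0∷-+ₚ (f *ₚ g) (f *ₚ h))) ⟩
    (scale a g +ₚ scale a h) +ₚ ((0# ∷ (f *ₚ g)) +ₚ (0# ∷ (f *ₚ h)))
      ≈⟨ +ₚ-interchange (scale a g) (scale a h) (0# ∷ (f *ₚ g)) (0# ∷ (f *ₚ h)) ⟩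
    (scale a g +ₚ (0# ∷ (f *ₚ g))) +ₚ (scale a h +ₚ (0# ∷ (f *ₚ h)))
      ∎
    where open ≋-Reasoning

  *ₚ-distribʳ : ∀ f g h → ((f +ₚ g) *ₚ h) ≋ ((f *ₚ h) +ₚ (g *ₚ h))
  *ₚ-distribʳ []      g       h = ≋-refl
  *ₚ-distribʳ (a ∷ f) []      h = ≋-sym (+ₚ-identityʳ ((a ∷ f) *ₚ h))
  *ₚ-distribʳ (a ∷ f) (b ∷ g) h = begin
    scale (a + b) h +ₚ (0# ∷ ((f +ₚ g) *ₚ h))
      ≈⟨ +ₚ-cong (scale-distribʳ a b h) (≋-trans (∷-cong refl (*ₚ-distribʳ f g h)) (0∷-+ₚ (f *ₚ h) (g *ₚ h))) ⟩
    (scale a h +ₚ scale b h) +ₚ ((0# ∷ (f *ₚ h)) +ₚ (0# ∷ (g *ₚ h)))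
      ≈⟨ +ₚ-interchange (scale a h) (scale b h) (0# ∷ (f *ₚ h)) (0# ∷ (g *ₚ h)) ⟩
    (scale a h +ₚ (0# ∷ (f *ₚ h))) +ₚ (scale b h +ₚ (0# ∷ (g *ₚ h)))
      ∎
    where open ≋-Reasoning

  scale-*ₚ : ∀ a f g → (scale a f *ₚ g) ≋ scale a (f *ₚ g)
  scale-*ₚ a []      g = ≋-refl
  scale-*ₚ a (b ∷ f) g = begin
    scale (a * b) g +ₚ (0# ∷ (scale a f *ₚ g))
      ≈⟨ +ₚ-cong (scale-assoc a b g) (≋-trans (∷-cong refl (scale-*ₚ a f g)) (0∷-scale a (f *ₚ g))) ⟩
    scale a (scale b g) +ₚ scale a (0# ∷ (f *ₚ g))
      ≈⟨ scale-distribˡ a (scale b g) (0# ∷ (f *ₚ g)) ⟨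
    scale a (scale b g +ₚ (0# ∷ (f *ₚ g)))
      ∎
    where open ≋-Reasoning

  *ₚ-scale : ∀ a f g → (f *ₚ scale a g) ≋ scale a (f *ₚ g)
  *ₚ-scale a []      g = ≋-refl
  *ₚ-scale a (b ∷ f) g = begin
    scale b (scale a g) +ₚ (0# ∷ (f *ₚ scale a g))
      ≈⟨ +ₚ-cong (scale-comm b a g) (≋-trans (∷-cong refl (*ₚ-scale a f g)) (0∷-scale a (f *ₚ g))) ⟩
    scale a (scale b g) +ₚ scale a (0# ∷ (f *ₚ g))
      ≈⟨ scale-distribˡ a (scale b g) (0# ∷ (f *ₚ g)) ⟨
    scale a (scale b g +ₚ (0# ∷ (f *ₚ g)))
      ∎
    where open ≋-Reasoning

  *ₚ-assoc : ∀ f g h → ((f *ₚ g) *ₚ h) ≋ (f *ₚ (g *ₚ h))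
  *ₚ-assoc []      g h = ≋-refl
  *ₚ-assoc (a ∷ f) g h = begin
    (scale a g +ₚ (0# ∷ (f *ₚ g))) *ₚ h
      ≈⟨ *ₚ-distribʳ (scale a g) _ h ⟩
    (scale a g *ₚ h) +ₚ ((0# ∷ (f *ₚ g)) *ₚ h)
      ≈⟨ +ₚ-cong (scale-*ₚ a g h) (≋-trans (0∷-*ₚ (f *ₚ g) h) (∷-cong refl (*ₚ-assoc f g h))) ⟩
    scale a (g *ₚ h) +ₚ (0# ∷ (f *ₚ (g *ₚ h)))
      ∎
    where open ≋-Reasoning

  *ₚ-∷ : ∀ f b g → (f *ₚ (b ∷ g)) ≋ (scale b f +ₚ (0# ∷ (f *ₚ g)))
  *ₚ-∷ []      b g = ≋-sym (∷-≋[] refl ≋-refl)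
  *ₚ-∷ (a ∷ f) b g = ∷-cong (+-congʳ (*-comm a b)) (begin
    scale a g +ₚ (f *ₚ (b ∷ g))                   ≈⟨ +ₚ-cong ≋-refl (*ₚ-∷ f b g) ⟩
    scale a g +ₚ (scale b f +ₚ (0# ∷ (f *ₚ g)))   ≈⟨ +ₚ-leftComm (scale a g) (scale b f) (0# ∷ (f *ₚ g)) ⟩
    scale b f +ₚ (scale a g +ₚ (0# ∷ (f *ₚ g)))   ∎)
    where open ≋-Reasoning

  *ₚ-identityʳ : ∀ f → (f *ₚ 1ₚ) ≋ f
  *ₚ-identityʳ []      = ≋-refl
  *ₚ-identityʳ (a ∷ f) = ∷-cong (trans (+-identityʳ _) (*-identityʳ a)) (*ₚ-identityʳ f)

  *ₚ-identityˡ : ∀ f → (1ₚ *ₚ f) ≋ f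
  *ₚ-identityˡ f = ≋-trans (+ₚ-cong (scale-identity f) (∷-≋[] refl ≋-refl)) (+ₚ-identityʳ f)

module Degree {c ℓ} (F : Field c ℓ) where
  open import Data.Nat as ℕ using (ℕ; zero; suc; _≤_; z≤n; s≤s; _≤?_)
  open import Data.Nat.Properties
    using (≤-trans; <⇒≤; <-≤-trans; ≰⇒>; m≤n⇒m<n∨m≡n; m≤n+m; +-suc; +-monoʳ-≤; +-monoʳ-<; <-cmp)
  open import Data.List using ([]; _∷_)
  open import Data.Product using (Σ; _×_; _,_; proj₁; proj₂)
  open import Data.Sum using (_⊎_; inj₁; inj₂)
  open import Data.Empty using (⊥-elim)
  open import Function.Bundles using (_⇔_; mk⇔; Equivalence)
  open import Relation.Nullary using (¬_; yes; no)
  open import Relation.Binary.Definitions using (tri<; tri≈; tri>)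
  open import Relation.Binary.PropositionalEquality as ≡ using (_≡_)
  open Field F hiding (zero)
  open Poly F
  open PolynomialRing F

  record MonicOfDegree (k : ℕ) (r : Pol) : Set ℓ where
    constructor monic
    field
      leading≈1 : coeff r k ≈ 1#
      degree<   : DegLt r (suc k)

  0≉1 : ¬ 0# ≈ 1#
  0≉1 0≈1 = 1≉0 (sym 0≈1)

  DegLt-resp : ∀ {n f g} → f ≋ g → DegLt f n → DegLt g n
  DegLt-resp f≋g f< l l≥ = trans (sym (coeff-≈ f≋g l)) (f< l l≥)

  MonicOfDegree-resp : ∀ {k f g} → f ≋ g → MonicOfDegree k f → MonicOfDegree k g
  MonicOfDegree-resp f≋g (monic top f<) = monic (trans (sym (coeff-≈ f≋g _)) top) (DegLt-resp f≋g f<)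

  DegLt-∷ : ∀ {n} b g → DegLt (b ∷ g) (suc n) ⇔ DegLt g n
  DegLt-∷ b g = mk⇔ (λ bg< l l≥ → bg< (suc l) (s≤s l≥)) (λ g< → λ { (suc l) (s≤s l≥) → g< l l≥ })

  MonicOfDegree-∷ : ∀ {k} b g → MonicOfDegree (suc k) (b ∷ g) ⇔ MonicOfDegree k g
  MonicOfDegree-∷ b g = mk⇔ (λ (monic top bg<) → monic top (Equivalence.to (DegLt-∷ b g) bg<))
                            (λ (monic top g<) → monic top (Equivalence.from (DegLt-∷ b g) g<))

  1ₚ-monic : MonicOfDegree 0 1ₚ
  1ₚ-monic = monic refl λ { (suc l) _ → refl }

  DegLt-suc : ∀ f {n} → DegLt f n → DegLt f (suc n)
  DegLt-suc f f< l n<l = f< l (<⇒≤ n<l)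

  DegLt-lower : ∀ f {n} → DegLt f (suc n) → coeff f n ≈ 0# → DegLt f n
  DegLt-lower f f< top≈0 l n≤l with m≤n⇒m<n∨m≡n n≤l
  ... | inj₁ n<l     = f< l n<l
  ... | inj₂ ≡.refl  = top≈0

  scale-DegLt : ∀ b f {n} → DegLt f n → DegLt (scale b f) n
  scale-DegLt b f f< l n≤l = trans (coeff-scale b f l) (trans (*-congˡ (f< l n≤l)) (zeroʳ b))

  Monic-exact : ∀ f {k} → Monic f → DegLt f (suc k) → ¬ coeff f k ≈ 0# → MonicOfDegree k f
  Monic-exact f {k} (d , top , above) f< top≉0 with <-cmp d k
  ... | tri< d<k _ _   = ⊥-elim (top≉0 (above k d<k))
  ... | tri> _ _ k<d   = ⊥-elim (0≉1 (trans (sym (f< d k<d)) top))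
  ... | tri≈ _ ≡.refl _ = monic top above

  Monic⇒MonicOfDegree : ∀ f (f-monic : Monic f) → MonicOfDegree (proj₁ f-monic) f
  Monic⇒MonicOfDegree f (d , top , above) = monic top above

  MonicOfDegree⇒Monic : ∀ {k f} → MonicOfDegree k f → Monic f
  MonicOfDegree⇒Monic {k} (monic top above) = k , top , above

  MonicOfDegree-0 : ∀ {r} → MonicOfDegree 0 r → r ≋ 1ₚ
  MonicOfDegree-0 (monic top r<) = mk≋ λ { zero → top ; (suc l) → r< (suc l) (s≤s z≤n) }

  ≋[]⊎degree : ∀ f → f ≋ [] ⊎ Σ ℕ λ d → ¬ coeff f d ≈ 0# × DegLt f (suc d)
  ≋[]⊎degree []      = inj₁ ≋-refl
  ≋[]⊎degree (b ∷ f) with ≋[]⊎degree f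
  ... | inj₂ (d , top≉0 , f<) = inj₂ (suc d , top≉0 , λ { (suc l) (s≤s l>) → f< l l> })
  ... | inj₁ f≋[] with b ≟ 0#
  ...   | yes b≈0 = inj₁ (∷-≋[] b≈0 f≋[])
  ...   | no  b≉0 = inj₂ (0 , b≉0 , λ { (suc l) _ → coeff-≈ f≋[] l })

  monic-*ₚ-top : ∀ {k r} a {i} → MonicOfDegree k r → DegLt a (suc i) →
    coeff (r *ₚ a) (k ℕ.+ i) ≈ coeff a i × DegLt (r *ₚ a) (suc (k ℕ.+ i))
  monic-*ₚ-top {zero} {r} a r-monic a< =
    coeff-≈ ra≋a _ , λ l l> → trans (coeff-≈ ra≋a l) (a< l l>)
    where
    ra≋a : (r *ₚ a) ≋ a
    ra≋a = ≋-trans (*ₚ-congˡ a (MonicOfDegree-0 r-monic)) (*ₚ-identityˡ a)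
  monic-*ₚ-top {suc k} {[]}    a (monic 0≈1 _) _ = ⊥-elim (0≉1 0≈1)
  monic-*ₚ-top {suc k} {b ∷ r} a {i} (monic top r<) a< =
    trans (shift (k ℕ.+ i) (m≤n+m i k)) (proj₁ ih) ,
    λ { (suc l) (s≤s l>) → trans (shift l (≤-trans (m≤n+m i k) (<⇒≤ l>))) (proj₂ ih l l>) }
    where
    ih = monic-*ₚ-top a (monic {k} {r} top λ l l> → r< (suc l) (s≤s l>)) a<
    shift : ∀ l → i ≤ l → coeff ((b ∷ r) *ₚ a) (suc l) ≈ coeff (r *ₚ a) l
    shift l i≤l = begin
      coeff ((b ∷ r) *ₚ a) (suc l)             ≈⟨ coeff-+ₚ (scale b a) (0# ∷ (r *ₚ a)) (suc l) ⟩
      coeff (scale b a) (suc l) + coeff (r *ₚ a) l ≈⟨ +-congʳ (coeff-scale b a (suc l)) ⟩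
      b * coeff a (suc l) + coeff (r *ₚ a) l   ≈⟨ +-congʳ (trans (*-congˡ (a< (suc l) (s≤s i≤l))) (zeroʳ b)) ⟩
      0# + coeff (r *ₚ a) l                    ≈⟨ +-identityˡ _ ⟩
      coeff (r *ₚ a) l                         ∎
      where open ≈-Reasoning

  monic-*ₚ-DegLt : ∀ {k r} a m → MonicOfDegree k r → DegLt a m → DegLt (r *ₚ a) (k ℕ.+ m)
  monic-*ₚ-DegLt {k} {r} a zero r-monic a< l _ =
    coeff-≈ (≋-trans (*ₚ-congʳ r (mk≋ λ j → a< j z≤n)) (*ₚ-zeroʳ r)) l
  monic-*ₚ-DegLt {k} a (suc m) r-monic a< l l≥ =
    proj₂ (monic-*ₚ-top a r-monic a<) l (≡.subst (ℕ._≤ l) (+-suc k m) l≥)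

  monic-*ₚ-DegLt⁻ : ∀ {k r} a m → MonicOfDegree k r → DegLt (r *ₚ a) (k ℕ.+ m) → DegLt a m
  monic-*ₚ-DegLt⁻ {k} a m r-monic ra< with ≋[]⊎degree a
  ... | inj₁ a≋[] = λ l _ → coeff-≈ a≋[] l
  ... | inj₂ (d , top≉0 , a<) with m ≤? d
  ...   | yes m≤d = ⊥-elim (top≉0 (trans (sym (proj₁ (monic-*ₚ-top a r-monic a<))) (ra< _ (+-monoʳ-≤ k m≤d))))
  ...   | no  m≰d = λ l m≤l → a< l (<-≤-trans (≰⇒> m≰d) m≤l)

  monic-*ₚ-monic : ∀ {k r a m} → MonicOfDegree k r → MonicOfDegree m a → MonicOfDegree (k ℕ.+ m) (r *ₚ a)
  monic-*ₚ-monic {a = a} r-monic (monic top a<) =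
    let (ra-top , ra<) = monic-*ₚ-top a r-monic a< in monic (trans ra-top top) ra<

  monic-*ₚ-monic⁻ : ∀ {k r} a m → MonicOfDegree k r → MonicOfDegree (k ℕ.+ m) (r *ₚ a) → MonicOfDegree m a
  monic-*ₚ-monic⁻ {k} {r} a m r-monic (monic ra-top ra<) with ≋[]⊎degree a
  ... | inj₁ a≋[] = ⊥-elim (0≉1 (trans (sym (coeff-≈ (≋-trans (*ₚ-congʳ r a≋[]) (*ₚ-zeroʳ r)) _)) ra-top))
  ... | inj₂ (d , top≉0 , a<) with monic-*ₚ-top a r-monic a< | <-cmp d m
  ...   | _ , ra<′ | tri< d<m _ _ = ⊥-elim (0≉1 (trans (sym (ra<′ _ (+-monoʳ-< k d<m))) ra-top))
  ...   | ra-top′ , _ | tri> _ _ m<d = ⊥-elim (top≉0 (trans (sym ra-top′) (ra< _ (+-monoʳ-< k m<d))))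
  ...   | ra-top′ , _ | tri≈ _ ≡.refl _ = monic (trans (sym ra-top′) ra-top) a<

  +ₚ-low : ∀ {k t} f → DegLt t k → ∀ l → k ≤ l → coeff (f +ₚ t) l ≈ coeff f l
  +ₚ-low f t< l k≤l = trans (coeff-+ₚ f _ l) (trans (+-congˡ (t< l k≤l)) (+-identityʳ _))

module Division {c ℓ} (F : Field c ℓ) where
  open import Data.Nat as ℕ using (ℕ; zero; _∸_; _≤_; z≤n; s≤s)
  open import Data.Nat.Properties as ℕₚ using (≤-trans; <⇒≤; m≤m+n; m≤n⇒m<n∨m≡n; m+[n∸m]≡n)
  open import Data.List using ([]; _∷_)
  open import Data.Product using (Σ; _×_; _,_)
  open import Data.Sum using (inj₁; inj₂)
  open import Function.Bundles using (_⇔_; mk⇔)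
  open import Relation.Binary.PropositionalEquality as ≡ using (_≡_)
  open Field F hiding (zero)
  open Poly F
  open PolynomialRing F
  open Degree F
  open import Algebra.Bundles using (CommutativeRing)
  open import Algebra.Properties.Ring (CommutativeRing.ring commRing) using (-1*x≈-x; -‿distribˡ-*)
  open import Algebra.Properties.Group +-group using (x∙y⁻¹≈ε⇒x≈y; x≈y⇒x∙y⁻¹≈ε; ∙-cancelˡ)
  open import Algebra.Properties.CommutativeSemigroup +-commutativeSemigroup using (interchange)

  -ₚ_ : Pol → Pol
  -ₚ f = scale (- 1#) f

  coeff-‿ : ∀ f i → coeff (-ₚ f) i ≈ - coeff f i
  coeff-‿ f i = trans (coeff-scale (- 1#) f i) (-1*x≈-x _)

  +ₚ-‿-cancel : ∀ f g → ((f +ₚ g) +ₚ (-ₚ f)) ≋ g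
  +ₚ-‿-cancel f g = +ₚ-pointwise (f +ₚ g) (-ₚ f) λ i → begin
    coeff (f +ₚ g) i + coeff (-ₚ f) i       ≈⟨ +-cong (coeff-+ₚ f g i) (coeff-‿ f i) ⟩
    (coeff f i + coeff g i) + - coeff f i   ≈⟨ +-congʳ (+-comm _ _) ⟩
    (coeff g i + coeff f i) + - coeff f i   ≈⟨ +-assoc _ _ _ ⟩
    coeff g i + (coeff f i + - coeff f i)   ≈⟨ +-congˡ (-‿inverseʳ _) ⟩
    coeff g i + 0#                          ≈⟨ +-identityʳ _ ⟩
    coeff g i                               ∎
    where open ≈-Reasoning

  +ₚ-scale-cancel : ∀ a r g h → ((scale a r +ₚ g) +ₚ (h +ₚ scale (- a) r)) ≋ (g +ₚ h)
  +ₚ-scale-cancel a r g h = +ₚ-pointwise (scale a r +ₚ g) (h +ₚ scale (- a) r) λ i → begin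
    coeff (scale a r +ₚ g) i + coeff (h +ₚ scale (- a) r) i
      ≈⟨ +-cong (trans (coeff-+ₚ (scale a r) g i) (+-congʳ (coeff-scale a r i)))
                (trans (coeff-+ₚ h (scale (- a) r) i) (+-congˡ (trans (coeff-scale (- a) r i) (sym (-‿distribˡ-* a _))))) ⟩
    (a * coeff r i + coeff g i) + (coeff h i + - (a * coeff r i))
      ≈⟨ +-congˡ (+-comm _ _) ⟩
    (a * coeff r i + coeff g i) + (- (a * coeff r i) + coeff h i)
      ≈⟨ interchange _ _ _ _ ⟩
    (a * coeff r i + - (a * coeff r i)) + (coeff g i + coeff h i)
      ≈⟨ trans (+-congʳ (-‿inverseʳ _)) (+-identityˡ _) ⟩
    coeff g i + coeff h i
      ≈⟨ coeff-+ₚ g h i ⟨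
    coeff (g +ₚ h) i
      ∎
    where open ≈-Reasoning

  divMod : ∀ {k r} → MonicOfDegree k r → ∀ f → Σ Pol λ a → Σ Pol λ t → DegLt t k × f ≋ ((r *ₚ a) +ₚ t)
  divMod {r = r} _ [] = [] , [] , (λ _ _ → refl) , ≋-sym (≋-trans (+ₚ-identityʳ (r *ₚ [])) (*ₚ-zeroʳ r))
  divMod {k} {r} r-monic@(monic leading≈1 r<) (b ∷ f) with divMod r-monic f
  ... | a , t , t< , f≋ = (lead ∷ a) , (u +ₚ scale (- lead) r) , remainder< , b∷f≋
    where
    open ≋-Reasoning
    u = b ∷ t
    lead = coeff u k
    coeff-remainder : ∀ l → coeff (u +ₚ scale (- lead) r) l ≈ coeff u l + - lead * coeff r l
    coeff-remainder l = trans (coeff-+ₚ u (scale (- lead) r) l) (+-congˡ (coeff-scale (- lead) r l))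
    remainder< : DegLt (u +ₚ scale (- lead) r) k
    remainder< l k≤l with m≤n⇒m<n∨m≡n k≤l
    ... | inj₂ ≡.refl = trans (coeff-remainder k)
                          (trans (+-congˡ (trans (*-congˡ leading≈1) (*-identityʳ _))) (-‿inverseʳ lead))
    ... | inj₁ k<l@(s≤s k≤l′) = trans (coeff-remainder l)
                          (trans (+-cong (t< _ k≤l′) (trans (*-congˡ (r< l k<l)) (zeroʳ _))) (+-identityˡ 0#))
    b∷f≋ : (b ∷ f) ≋ ((r *ₚ (lead ∷ a)) +ₚ (u +ₚ scale (- lead) r))
    b∷f≋ = ≋-sym (begin
      (r *ₚ (lead ∷ a)) +ₚ (u +ₚ scale (- lead) r)
        ≈⟨ +ₚ-cong (*ₚ-∷ r lead a) ≋-refl ⟩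
      (scale lead r +ₚ (0# ∷ (r *ₚ a))) +ₚ (u +ₚ scale (- lead) r)
        ≈⟨ +ₚ-scale-cancel lead r (0# ∷ (r *ₚ a)) u ⟩
      (0# + b) ∷ ((r *ₚ a) +ₚ t)
        ≈⟨ ∷-cong (+-identityˡ b) (≋-sym f≋) ⟩
      b ∷ f
        ∎)

  divMod-unique : ∀ {k r} a₁ a₂ t₁ t₂ → MonicOfDegree k r → DegLt t₁ k → DegLt t₂ k →
    ((r *ₚ a₁) +ₚ t₁) ≋ ((r *ₚ a₂) +ₚ t₂) → a₁ ≋ a₂ × t₁ ≋ t₂
  divMod-unique {k} {r} a₁ a₂ t₁ t₂ r-monic t₁< t₂< eq = a₁≋a₂ , t₁≋t₂
    where
    diff = a₁ +ₚ (-ₚ a₂)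
    high-agree : ∀ l → k ≤ l → coeff (r *ₚ a₁) l ≈ coeff (r *ₚ a₂) l
    high-agree l k≤l =
      trans (sym (+ₚ-low (r *ₚ a₁) t₁< l k≤l)) (trans (coeff-≈ eq l) (+ₚ-low (r *ₚ a₂) t₂< l k≤l))
    coeff-r*diff : ∀ l → coeff (r *ₚ diff) l ≈ coeff (r *ₚ a₁) l + - coeff (r *ₚ a₂) l
    coeff-r*diff l = trans (coeff-≈ (*ₚ-distribˡ r a₁ (-ₚ a₂)) l) (trans (coeff-+ₚ (r *ₚ a₁) _ l)
                       (+-congˡ (trans (coeff-≈ (*ₚ-scale (- 1#) r a₂) l) (coeff-‿ (r *ₚ a₂) l))))
    r*diff< : DegLt (r *ₚ diff) (k ℕ.+ 0)
    r*diff< l k+0≤l = let k≤l = ≡.subst (_≤ l) (ℕₚ.+-identityʳ k) k+0≤l in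
      trans (coeff-r*diff l) (x≈y⇒x∙y⁻¹≈ε (high-agree l k≤l))
    a₁≋a₂ : a₁ ≋ a₂
    a₁≋a₂ = mk≋ λ i → x∙y⁻¹≈ε⇒x≈y _ _
      (trans (sym (trans (coeff-+ₚ a₁ _ i) (+-congˡ (coeff-‿ a₂ i)))) (monic-*ₚ-DegLt⁻ diff 0 r-monic r*diff< i z≤n))
    t₁≋t₂ : t₁ ≋ t₂
    t₁≋t₂ = mk≋ λ i → ∙-cancelˡ (coeff (r *ₚ a₂) i) _ _
      (trans (+-congʳ (sym (coeff-≈ (*ₚ-congʳ r a₁≋a₂) i)))
        (trans (sym (coeff-+ₚ (r *ₚ a₁) t₁ i)) (trans (coeff-≈ eq i) (coeff-+ₚ (r *ₚ a₂) t₂ i))))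

  remainder-DegLt : ∀ {k r t} a {n} → k ≤ n → MonicOfDegree k r → DegLt t k →
    DegLt ((r *ₚ a) +ₚ t) n ⇔ DegLt a (n ∸ k)
  remainder-DegLt {k} {r} {t} a {n} k≤n r-monic t< =
    ≡.subst (λ n′ → DegLt ((r *ₚ a) +ₚ t) n′ ⇔ DegLt a (n ∸ k)) (m+[n∸m]≡n k≤n) (remainder-DegLt′ (n ∸ k))
    where
    remainder-DegLt′ : ∀ m → DegLt ((r *ₚ a) +ₚ t) (k ℕ.+ m) ⇔ DegLt a m
    remainder-DegLt′ m = mk⇔
      (λ ra+t< → monic-*ₚ-DegLt⁻ a m r-monic λ l l≥ → trans (sym (low l l≥)) (ra+t< l l≥))
      (λ a< l l≥ → trans (low l l≥) (monic-*ₚ-DegLt a m r-monic a< l l≥))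
      where
      low : ∀ l → k ℕ.+ m ≤ l → coeff ((r *ₚ a) +ₚ t) l ≈ coeff (r *ₚ a) l
      low l l≥ = +ₚ-low (r *ₚ a) t< l (≤-trans (m≤m+n k m) l≥)

  remainder-MonicOfDegree : ∀ {k r t} a {e} → k ≤ e → MonicOfDegree k r → DegLt t k →
    MonicOfDegree e ((r *ₚ a) +ₚ t) ⇔ MonicOfDegree (e ∸ k) a
  remainder-MonicOfDegree {k} {r} {t} a {e} k≤e r-monic t< =
    ≡.subst (λ e′ → MonicOfDegree e′ ((r *ₚ a) +ₚ t) ⇔ MonicOfDegree (e ∸ k) a) (m+[n∸m]≡n k≤e)
      (remainder-MonicOfDegree′ (e ∸ k))
    where
    low : ∀ l → k ≤ l → coeff ((r *ₚ a) +ₚ t) l ≈ coeff (r *ₚ a) l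
    low l k≤l = +ₚ-low (r *ₚ a) t< l k≤l
    remainder-MonicOfDegree′ : ∀ m → MonicOfDegree (k ℕ.+ m) ((r *ₚ a) +ₚ t) ⇔ MonicOfDegree m a
    remainder-MonicOfDegree′ m = mk⇔
      (λ (monic top ra+t<) → monic-*ₚ-monic⁻ a m r-monic
         (monic (trans (sym (low _ k≤k+m)) top) (λ l l> → trans (sym (low l (k≤ l>))) (ra+t< l l>))))
      (λ a-monic → let monic top ra< = monic-*ₚ-monic r-monic a-monic in
         monic (trans (low _ k≤k+m) top) (λ l l> → trans (low l (k≤ l>)) (ra< l l>)))
      where
      k≤k+m = m≤m+n k m
      k≤ : ∀ {l} → k ℕ.+ m ℕ.< l → k ≤ l
      k≤ l> = ≤-trans k≤k+m (<⇒≤ l>)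

module Coprimality {c ℓ} (F : Field c ℓ) where
  open import Data.Nat as ℕ using (zero; suc; z≤n)
  open import Data.List using ([])
  open import Data.Product using (_,_)
  open import Data.Empty using (⊥-elim)
  open import Function.Bundles using (_⇔_; mk⇔)
  open Field F hiding (zero)
  open Poly F
  open PolynomialRing F
  open Degree F
  open Division F

  ∣ₚ-resp : ∀ d {f g} → d ∣ₚ f → f ≋ g → d ∣ₚ g
  ∣ₚ-resp d (h , dh≈f) f≋g = h , λ i → trans (dh≈f i) (coeff-≈ f≋g i)

  ∣ₚ-+ₚ : ∀ d f g → d ∣ₚ f → d ∣ₚ g → d ∣ₚ (f +ₚ g)
  ∣ₚ-+ₚ d f g (h₁ , dh₁≈f) (h₂ , dh₂≈g) =
    h₁ +ₚ h₂ ,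
    coeff-≈ (≋-trans (*ₚ-distribˡ d h₁ h₂) (+ₚ-cong (mk≋ {d *ₚ h₁} {f} dh₁≈f) (mk≋ {d *ₚ h₂} {g} dh₂≈g)))

  ∣ₚ-*ₚ : ∀ d f a → d ∣ₚ f → d ∣ₚ (f *ₚ a)
  ∣ₚ-*ₚ d f a (h , dh≈f) =
    h *ₚ a , coeff-≈ (≋-trans (≋-sym (*ₚ-assoc d h a)) (*ₚ-congˡ a (mk≋ {d *ₚ h} {f} dh≈f)))

  ∣ₚ-scale : ∀ d f b → d ∣ₚ f → d ∣ₚ scale b f
  ∣ₚ-scale d f b (h , dh≈f) =
    scale b h , coeff-≈ (≋-trans (*ₚ-scale b d h) (scale-cong refl (mk≋ {d *ₚ h} {f} dh≈f)))

  Coprime-resp : ∀ {f f′ g g′} → f ≋ f′ → g ≋ g′ → Coprime f g → Coprime f′ g′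
  Coprime-resp f≋f′ g≋g′ coprime d d∣f′ d∣g′ =
    coprime d (∣ₚ-resp d d∣f′ (≋-sym f≋f′)) (∣ₚ-resp d d∣g′ (≋-sym g≋g′))

  Coprime-sym : ∀ f g → Coprime f g → Coprime g f
  Coprime-sym f g coprime d d∣g d∣f = coprime d d∣f d∣g

  Coprime-+ₚ-multiple : ∀ r a t → Coprime ((r *ₚ a) +ₚ t) r ⇔ Coprime t r
  Coprime-+ₚ-multiple r a t = mk⇔
    (λ coprime d d∣t d∣r → coprime d (∣ₚ-+ₚ d (r *ₚ a) t (∣ₚ-*ₚ d r a d∣r) d∣t) d∣r)
    (λ coprime d d∣f d∣r → coprime d
      (∣ₚ-resp d (∣ₚ-+ₚ d ((r *ₚ a) +ₚ t) (-ₚ (r *ₚ a)) d∣f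
                    (∣ₚ-scale d (r *ₚ a) (- 1#) (∣ₚ-*ₚ d r a d∣r)))
        (+ₚ-‿-cancel (r *ₚ a) t)) d∣r)

  Coprime-scale : ∀ f g u v → u * v ≈ 1# → Coprime f g → Coprime (scale u f) g
  Coprime-scale f g u v uv≈1 coprime d d∣uf d∣g =
    coprime d (∣ₚ-resp d (∣ₚ-scale d (scale u f) v d∣uf) (scale-inverse f (trans (*-comm v u) uv≈1))) d∣g

  Coprime-1ₚ : ∀ f {g} → g ≋ 1ₚ → Coprime f g
  Coprime-1ₚ f g≋1 d _ d∣g = ∣ₚ-resp d d∣g g≋1

  Coprime-[]-monic : ∀ {f r} k → f ≋ [] → Coprime f r → MonicOfDegree k r → r ≋ 1ₚ
  Coprime-[]-monic zero f≋[] coprime r-monic = MonicOfDegree-0 r-monic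
  Coprime-[]-monic {r = r} (suc k) f≋[] coprime r-monic
    with coprime r ([] , coeff-≈ (≋-trans (*ₚ-zeroʳ r) (≋-sym f≋[]))) (1ₚ , coeff-≈ (*ₚ-identityʳ r))
  ... | h , rh≈1 = ⊥-elim (1≉0 (trans (sym (rh≈1 0)) (coeff-≈ rh≋[] 0)))
    where
    rh< : DegLt (r *ₚ h) (suc k ℕ.+ 0)
    rh< (suc l) _ = rh≈1 (suc l)
    rh≋[] : (r *ₚ h) ≋ []
    rh≋[] = ≋-trans (*ₚ-congʳ r (mk≋ λ i → monic-*ₚ-DegLt⁻ h 0 r-monic rh< i z≤n)) (*ₚ-zeroʳ r)

module Numerics (p : Data.Nat.ℕ) where
  open import Data.Nat using (ℕ; suc; zero; _+_; _*_; _∸_; _^_; _≤_; s≤s)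
  open import Data.Nat.Properties
    using (+-suc; +-assoc; +-identityʳ; *-identityʳ; ^-distribˡ-+-*; m∸n+n≡m; ≤-trans; n≤1+n; +-∸-assoc; m^n>0)
  open import Data.Nat.Tactic.RingSolver using (solve-∀)
  open import Relation.Binary.PropositionalEquality using (_≡_; sym; trans; cong)
  open Relation.Binary.PropositionalEquality.≡-Reasoning

  q : ℕ
  q = suc p

  -- A(e, j) of the proof sketch; only meaningful for j ≤ e.
  lowCoprimeCount : ℕ → ℕ → ℕ
  lowCoprimeCount zero    _       = 1
  lowCoprimeCount (suc e) zero    = 0
  lowCoprimeCount (suc e) (suc j) = p * q ^ (e + suc j)

  pairCount : ℕ → ℕ → ℕ
  pairCount N₁ zero    = 0
  pairCount N₁ (suc k) = q ^ (N₁ + k)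

  q^[n∸m]*q^[m+l] : ∀ {m n} l → m ≤ n → q ^ (n ∸ m) * q ^ (m + l) ≡ q ^ (n + l)
  q^[n∸m]*q^[m+l] {m} {n} l m≤n = begin
    q ^ (n ∸ m) * q ^ (m + l) ≡⟨ ^-distribˡ-+-* q (n ∸ m) (m + l) ⟨
    q ^ (n ∸ m + (m + l))     ≡⟨ cong (q ^_) (+-assoc (n ∸ m) m l) ⟨
    q ^ (n ∸ m + m + l)       ≡⟨ cong (λ k → q ^ (k + l)) (m∸n+n≡m m≤n) ⟩
    q ^ (n + l)               ∎

  x*[p*y]≡p*[x*y] : ∀ x y → x * (p * y) ≡ p * (x * y)
  x*[p*y]≡p*[x*y] x y = x*[m*y]≡m*[x*y] x p y
    where
    x*[m*y]≡m*[x*y] : ∀ x m y → x * (m * y) ≡ m * (x * y)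
    x*[m*y]≡m*[x*y] = solve-∀

  lowCoprimeCount-suc : ∀ e j → suc j ≤ e →
    lowCoprimeCount e (suc j) ≡ lowCoprimeCount e j + p * (q ^ (e ∸ j) * lowCoprimeCount j j)
  lowCoprimeCount-suc (suc e) zero _ = begin
    p * q ^ (e + 1)           ≡⟨ cong (λ n → p * q ^ n) (trans (+-suc e 0) (cong suc (+-identityʳ e))) ⟩
    p * q ^ suc e             ≡⟨ cong (p *_) (*-identityʳ (q ^ suc e)) ⟨
    p * (q ^ suc e * 1)       ∎
  lowCoprimeCount-suc (suc e) (suc j) (s≤s sj≤e) = begin
    p * q ^ (e + suc (suc j))                   ≡⟨ cong (λ n → p * q ^ n) (+-suc e (suc j)) ⟩
    p * (q * X)                                 ≡⟨ m*[[1+m]*x] p X ⟩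
    p * X + p * (p * X)
      ≡⟨ cong (λ y → p * X + p * (p * y)) (q^[n∸m]*q^[m+l] (suc j) j≤e) ⟨
    p * X + p * (p * (q ^ (e ∸ j) * q ^ (j + suc j)))
      ≡⟨ cong (λ y → p * X + p * y) (x*[p*y]≡p*[x*y] (q ^ (e ∸ j)) _) ⟨
    p * X + p * (q ^ (e ∸ j) * (p * q ^ (j + suc j)))
      ∎
    where
    X = q ^ (e + suc j)
    j≤e = ≤-trans (n≤1+n j) sj≤e
    m*[[1+m]*x] : ∀ m x → m * (suc m * x) ≡ m * x + m * (m * x)
    m*[[1+m]*x] = solve-∀

  pairCount-suc : ∀ N₁ k → suc k ≤ N₁ →
    pairCount N₁ (suc k) ≡ pairCount N₁ k + q ^ (N₁ ∸ k) * lowCoprimeCount k k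
  pairCount-suc N₁ zero _ = trans (cong (q ^_) (+-identityʳ N₁)) (sym (*-identityʳ (q ^ N₁)))
  pairCount-suc N₁ (suc k) sk<N₁ = begin
    q ^ (N₁ + suc k)                      ≡⟨ cong (q ^_) (+-suc N₁ k) ⟩
    X + p * X                             ≡⟨ cong (λ y → X + p * y) (q^[n∸m]*q^[m+l] k sk≤N₁) ⟨
    X + p * (q ^ (N₁ ∸ suc k) * q ^ (suc k + k))
      ≡⟨ cong (λ n → X + p * (q ^ (N₁ ∸ suc k) * q ^ n)) (+-suc k k) ⟨
    X + p * (q ^ (N₁ ∸ suc k) * q ^ (k + suc k))
      ≡⟨ cong (X +_) (x*[p*y]≡p*[x*y] (q ^ (N₁ ∸ suc k)) _) ⟨
    X + q ^ (N₁ ∸ suc k) * (p * q ^ (k + suc k)) ∎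
    where
    X = q ^ (N₁ + k)
    sk≤N₁ = ≤-trans (n≤1+n (suc k)) sk<N₁

  pairCount≡ : ∀ N₁ N₂ → 1 ≤ N₂ → pairCount N₁ N₂ ≡ suc (q ^ (N₁ + N₂ ∸ 1) ∸ 1)
  pairCount≡ N₁ (suc k) _ = begin
    q ^ (N₁ + k)                ≡⟨ +-∸-assoc 1 (m^n>0 q (N₁ + k)) ⟩
    suc (q ^ (N₁ + k) ∸ 1)      ≡⟨ cong (λ n → suc (q ^ n ∸ 1)) (cong (_∸ 1) (+-suc N₁ k)) ⟨
    suc (q ^ (N₁ + suc k ∸ 1) ∸ 1) ∎

module CoprimePairCount {c ℓ} (F : Field c ℓ) (p : Data.Nat.ℕ) (card : HasCard F (Data.Nat.suc p)) where
  open import Level using (_⊔_)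
  open import Data.Nat as ℕ using (ℕ; zero; suc; _∸_; _^_; _≤_; z≤n)
  open import Data.Nat.Properties using (≤-refl; ≤-trans; n≤1+n)
  open import Data.List using ([]; _∷_; drop)
  open import Data.Product using (Σ; _×_; _,_; proj₁; proj₂)
  open import Data.Product.Relation.Binary.Pointwise.NonDependent using (Pointwise; ×-setoid)
  open import Data.Sum using (_⊎_; inj₁; inj₂)
  open import Data.Unit using (⊤; tt)
  open import Function.Bundles using (_⇔_; mk⇔; Equivalence)
  open import Relation.Nullary using (¬_; yes; no)
  open import Relation.Binary using (Setoid)
  open import Relation.Binary.PropositionalEquality as ≡ using (_≡_)
  open Field F hiding (zero)
  open Poly F
  open PolynomialRing F
  open Degree F
  open Division F
  open Coprimality F
  open Counting
  open Numerics p
  open Equivalence using (to; from)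

  Pair : Set c
  Pair = Pol × Pol

  _≋₂_ : Pair → Pair → Set ℓ
  _≋₂_ = Pointwise _≋_ _≋_

  ≋₂-setoid : Setoid c ℓ
  ≋₂-setoid = ×-setoid ≋-setoid ≋-setoid

  count-Carrier : HasCount _≈_ (λ _ → ⊤) q
  count-Carrier = record
    { elem = enum ; elem-P = λ _ → tt ; elem-inj = enum-inj ; elem-cover = λ x _ → enum-surj x }
    where open HasCard card

  count-nonzero : HasCount _≈_ (λ x → ⊤ × ¬ x ≈ 0#) p
  count-nonzero = HasCount-remove setoid count-Carrier 0# tt

  ∷-drop : ∀ f → f ≋ (coeff f 0 ∷ drop 1 f)
  ∷-drop []      = ≋-sym (∷-≋[] refl ≋-refl)
  ∷-drop (b ∷ f) = ≋-refl

  count-∷ : ∀ {n} {P Q : Pol → Set ℓ} → (∀ {f g} → f ≋ g → P f → P g) → (∀ b g → P (b ∷ g) ⇔ Q g) →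
    HasCount _≋_ Q n → HasCount _≋_ P (q ℕ.* n)
  count-∷ P-resp P⇔Q CQ = HasCount-map ≋-setoid (λ (b , g) → b ∷ g)
    (λ _ _ (b≈b′ , g≋g′) → ∷-cong b≈b′ g≋g′)
    (λ (b , g) (_ , Qg) → from (P⇔Q b g) Qg)
    (λ _ _ _ _ bg≋b′g′ → coeff-≈ bg≋b′g′ 0 , mk≋ λ i → coeff-≈ bg≋b′g′ (suc i))
    (λ f Pf → (coeff f 0 , drop 1 f) , (tt , to (P⇔Q _ _) (P-resp (∷-drop f) Pf)) , ≋-sym (∷-drop f))
    (HasCount-× count-Carrier CQ)

  count-DegLt : ∀ m → HasCount _≋_ (λ f → DegLt f m) (q ^ m)
  count-DegLt zero    = HasCount-singleton [] (λ _ _ → refl) (λ f f<0 → mk≋ λ i → sym (f<0 i z≤n))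
  count-DegLt (suc m) = count-∷ DegLt-resp DegLt-∷ (count-DegLt m)

  count-MonicOfDegree : ∀ m → HasCount _≋_ (MonicOfDegree m) (q ^ m)
  count-MonicOfDegree zero    = HasCount-singleton 1ₚ 1ₚ-monic (λ r r-monic → ≋-sym (MonicOfDegree-0 r-monic))
  count-MonicOfDegree (suc m) = count-∷ MonicOfDegree-resp MonicOfDegree-∷ (count-MonicOfDegree m)

  LowCoprime : ℕ → ℕ → Pair → Set (c ⊔ ℓ)
  LowCoprime e j (s , r) = DegLt s j × MonicOfDegree e r × Coprime s r

  ExactCoprime : ℕ → ℕ → Pair → Set (c ⊔ ℓ)
  ExactCoprime e j (s , r) = DegLt s (suc j) × ¬ coeff s j ≈ 0# × MonicOfDegree e r × Coprime s r

  MonicCoprime : ℕ → (Pol → Set ℓ) → Pair → Set (c ⊔ ℓ)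
  MonicCoprime k P (f , r) = P f × MonicOfDegree k r × Coprime f r

  BoundedCoprime : ℕ → ℕ → Pair → Set (c ⊔ ℓ)
  BoundedCoprime N₁ k (f , g) = DegLt f N₁ × (Monic g × DegLt g k) × Coprime f g

  count-MonicCoprime : ∀ {k m n} {P Q : Pol → Set ℓ} → (∀ {f g} → f ≋ g → P f → P g) →
    (∀ {r t} a → MonicOfDegree k r → DegLt t k → P ((r *ₚ a) +ₚ t) ⇔ Q a) →
    HasCount _≋_ Q m → HasCount _≋₂_ (LowCoprime k k) n → HasCount _≋₂_ (MonicCoprime k P) (m ℕ.* n)
  count-MonicCoprime {k} {P = P} {Q} P-resp P⇔Q CQ CA =
    HasCount-map ≋₂-setoid φ φ-cong φ-P φ-inj φ-surj (HasCount-× CQ CA)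
    where
    φ : Pol × Pair → Pair
    φ (a , (t , r)) = (r *ₚ a) +ₚ t , r
    φ-cong : ∀ x y → Pointwise _≋_ _≋₂_ x y → φ x ≋₂ φ y
    φ-cong _ _ (a≋a′ , (t≋t′ , r≋r′)) = +ₚ-cong (*ₚ-cong r≋r′ a≋a′) t≋t′ , r≋r′
    φ-P : ∀ x → Q (proj₁ x) × LowCoprime k k (proj₂ x) → MonicCoprime k P (φ x)
    φ-P (a , (t , r)) (Qa , t< , r-monic , coprime) =
      from (P⇔Q a r-monic t<) Qa , r-monic , from (Coprime-+ₚ-multiple r a t) coprime
    φ-inj : ∀ x y → Q (proj₁ x) × LowCoprime k k (proj₂ x) → Q (proj₁ y) × LowCoprime k k (proj₂ y) →
      φ x ≋₂ φ y → Pointwise _≋_ _≋₂_ x y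
    φ-inj (a₁ , (t₁ , r₁)) (a₂ , (t₂ , r₂)) (_ , t₁< , r₁-monic , _) (_ , t₂< , _) (φ₁≋φ₂ , r₁≋r₂) =
      let (a₁≋a₂ , t₁≋t₂) = divMod-unique a₁ a₂ t₁ t₂ r₁-monic t₁< t₂<
                              (≋-trans φ₁≋φ₂ (+ₚ-cong (*ₚ-congˡ a₂ (≋-sym r₁≋r₂)) ≋-refl))
      in  a₁≋a₂ , (t₁≋t₂ , r₁≋r₂)
    φ-surj : ∀ y → MonicCoprime k P y → Σ (Pol × Pair) λ x → (Q (proj₁ x) × LowCoprime k k (proj₂ x)) × φ x ≋₂ y
    φ-surj (f , r) (Pf , r-monic , coprime) with divMod r-monic f
    ... | a , t , t< , f≋ra+t =
      (a , (t , r)) ,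
      (to (P⇔Q a r-monic t<) (P-resp f≋ra+t Pf) , t< , r-monic ,
       to (Coprime-+ₚ-multiple r a t) (Coprime-resp f≋ra+t (≋-refl {r}) coprime)) ,
      (≋-sym f≋ra+t , ≋-refl)

  count-ExactCoprime : ∀ {e j n} → HasCount _≋₂_ (MonicCoprime j (MonicOfDegree e)) n →
    HasCount _≋₂_ (ExactCoprime e j) (p ℕ.* n)
  count-ExactCoprime {e} {j} C = HasCount-map ≋₂-setoid ψ ψ-cong ψ-P ψ-inj ψ-surj (HasCount-× count-nonzero C)
    where
    ψ : Carrier × Pair → Pair
    ψ (b , (r , s)) = scale b s , r
    coeff-scale-leading : ∀ b {s} → MonicOfDegree j s → coeff (scale b s) j ≈ b
    coeff-scale-leading b {s} (monic top _) = trans (coeff-scale b s j) (trans (*-congˡ top) (*-identityʳ b))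
    ψ-cong : ∀ x y → Pointwise _≈_ _≋₂_ x y → ψ x ≋₂ ψ y
    ψ-cong _ _ (b≈b′ , (r≋r′ , s≋s′)) = scale-cong b≈b′ s≋s′ , r≋r′
    ψ-P : ∀ x → (⊤ × ¬ proj₁ x ≈ 0#) × MonicCoprime j (MonicOfDegree e) (proj₂ x) → ExactCoprime e j (ψ x)
    ψ-P (b , (r , s)) ((_ , b≉0) , r-monic , s-monic , coprime) =
      scale-DegLt b s (MonicOfDegree.degree< s-monic) ,
      (λ bs≈0 → b≉0 (trans (sym (coeff-scale-leading b s-monic)) bs≈0)) ,
      r-monic ,
      Coprime-scale s r b (proj₁ (inv b b≉0)) (proj₂ (inv b b≉0)) (Coprime-sym r s coprime)
    ψ-inj : ∀ x y → (⊤ × ¬ proj₁ x ≈ 0#) × MonicCoprime j (MonicOfDegree e) (proj₂ x) →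
      (⊤ × ¬ proj₁ y ≈ 0#) × MonicCoprime j (MonicOfDegree e) (proj₂ y) → ψ x ≋₂ ψ y → Pointwise _≈_ _≋₂_ x y
    ψ-inj (b₁ , (r₁ , s₁)) (b₂ , (r₂ , s₂)) ((_ , b₁≉0) , _ , s₁-monic , _) (_ , _ , s₂-monic , _)
          (b₁s₁≋b₂s₂ , r₁≋r₂) =
      b₁≈b₂ , (r₁≋r₂ , s₁≋s₂)
      where
      b₁⁻¹ = proj₁ (inv b₁ b₁≉0)
      b₁⁻¹b₁≈1 = trans (*-comm b₁⁻¹ b₁) (proj₂ (inv b₁ b₁≉0))
      b₁≈b₂ = trans (sym (coeff-scale-leading b₁ s₁-monic))
                    (trans (coeff-≈ b₁s₁≋b₂s₂ j) (coeff-scale-leading b₂ s₂-monic))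
      s₁≋s₂ = ≋-trans (≋-sym (scale-inverse s₁ b₁⁻¹b₁≈1))
                (≋-trans (scale-cong refl (≋-trans b₁s₁≋b₂s₂ (scale-cong (sym b₁≈b₂) ≋-refl)))
                         (scale-inverse s₂ b₁⁻¹b₁≈1))
    ψ-surj : ∀ y → ExactCoprime e j y →
      Σ (Carrier × Pair) λ x → ((⊤ × ¬ proj₁ x ≈ 0#) × MonicCoprime j (MonicOfDegree e) (proj₂ x)) × ψ x ≋₂ y
    ψ-surj (s , r) (s< , lead≉0 , r-monic , coprime) =
      (lead , (r , scale lead⁻¹ s)) ,
      ((tt , lead≉0) , r-monic , monic-s′ ,
       Coprime-sym (scale lead⁻¹ s) r (Coprime-scale s r lead⁻¹ lead (trans (*-comm lead⁻¹ lead) lead*lead⁻¹≈1) coprime)) ,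
      (scale-inverse s lead*lead⁻¹≈1 , ≋-refl)
      where
      lead = coeff s j
      lead⁻¹ = proj₁ (inv lead lead≉0)
      lead*lead⁻¹≈1 = proj₂ (inv lead lead≉0)
      monic-s′ : MonicOfDegree j (scale lead⁻¹ s)
      monic-s′ = monic (trans (coeff-scale lead⁻¹ s j) (trans (*-comm lead⁻¹ lead) lead*lead⁻¹≈1))
                       (scale-DegLt lead⁻¹ s s<)

  count-LowCoprime : ∀ j e → j ≤ e → HasCount _≋₂_ (LowCoprime e j) (lowCoprimeCount e j)
  count-LowCoprime zero zero _ =
    HasCount-singleton ([] , 1ₚ) ((λ _ _ → refl) , 1ₚ-monic , Coprime-1ₚ [] ≋-refl)
      (λ (s , r) (s<0 , r-monic , _) → mk≋ (λ i → sym (s<0 i z≤n)) , ≋-sym (MonicOfDegree-0 r-monic))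
  count-LowCoprime zero (suc e) _ = HasCount-∅ λ (s , r) (s<0 , r-monic , coprime) →
    let r≋1 = Coprime-[]-monic (suc e) (mk≋ {s} λ i → s<0 i z≤n) coprime r-monic
    in  0≉1 (trans (sym (coeff-≈ r≋1 (suc e))) (MonicOfDegree.leading≈1 r-monic))
  count-LowCoprime (suc j) e sj≤e =
    HasCount-resp-≡ (≡.sym (lowCoprimeCount-suc e j sj≤e))
      (HasCount-⊎ ≋₂-setoid (count-LowCoprime j e j≤e) count-exact split low⇒ exact⇒ disjoint)
    where
    j≤e = ≤-trans (n≤1+n j) sj≤e
    count-exact : HasCount _≋₂_ (ExactCoprime e j) (p ℕ.* (q ^ (e ∸ j) ℕ.* lowCoprimeCount j j))
    count-exact = count-ExactCoprime
      (count-MonicCoprime MonicOfDegree-resp (λ a → remainder-MonicOfDegree a j≤e)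
        (count-MonicOfDegree (e ∸ j)) (count-LowCoprime j j ≤-refl))
    split : ∀ x → LowCoprime e (suc j) x → LowCoprime e j x ⊎ ExactCoprime e j x
    split (s , r) (s< , r-monic , coprime) with coeff s j ≟ 0#
    ... | yes top≈0 = inj₁ (DegLt-lower s s< top≈0 , r-monic , coprime)
    ... | no  top≉0 = inj₂ (s< , top≉0 , r-monic , coprime)
    low⇒ : ∀ x → LowCoprime e j x → LowCoprime e (suc j) x
    low⇒ (s , r) (s< , r-monic , coprime) = DegLt-suc s s< , r-monic , coprime
    exact⇒ : ∀ x → ExactCoprime e j x → LowCoprime e (suc j) x
    exact⇒ _ (s< , _ , r-monic , coprime) = s< , r-monic , coprime
    disjoint : ∀ x y → LowCoprime e j x → ExactCoprime e j y → ¬ x ≋₂ y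
    disjoint _ _ (s< , _) (_ , top≉0 , _) (s≋s′ , _) = top≉0 (trans (sym (coeff-≈ s≋s′ j)) (s< j ≤-refl))

  count-BoundedCoprime : ∀ N₁ k → k ≤ N₁ → HasCount _≋₂_ (BoundedCoprime N₁ k) (pairCount N₁ k)
  count-BoundedCoprime N₁ zero _ = HasCount-∅ λ (f , g) (_ , (g-monic , g<0) , _) →
    0≉1 (trans (sym (g<0 _ z≤n)) (MonicOfDegree.leading≈1 (Monic⇒MonicOfDegree g g-monic)))
  count-BoundedCoprime N₁ (suc k) sk≤N₁ =
    HasCount-resp-≡ (≡.sym (pairCount-suc N₁ k sk≤N₁))
      (HasCount-⊎ ≋₂-setoid (count-BoundedCoprime N₁ k k≤N₁) count-exact split low⇒ exact⇒ disjoint)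
    where
    k≤N₁ = ≤-trans (n≤1+n k) sk≤N₁
    count-exact : HasCount _≋₂_ (MonicCoprime k (λ f → DegLt f N₁)) (q ^ (N₁ ∸ k) ℕ.* lowCoprimeCount k k)
    count-exact = count-MonicCoprime DegLt-resp (λ a → remainder-DegLt a k≤N₁)
      (count-DegLt (N₁ ∸ k)) (count-LowCoprime k k ≤-refl)
    split : ∀ x → BoundedCoprime N₁ (suc k) x → BoundedCoprime N₁ k x ⊎ MonicCoprime k (λ f → DegLt f N₁) x
    split (f , g) (f< , (g-monic , g<) , coprime) with coeff g k ≟ 0#
    ... | yes top≈0 = inj₁ (f< , (g-monic , DegLt-lower g g< top≈0) , coprime)
    ... | no  top≉0 = inj₂ (f< , Monic-exact g g-monic g< top≉0 , coprime)
    low⇒ : ∀ x → BoundedCoprime N₁ k x → BoundedCoprime N₁ (suc k) x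
    low⇒ (f , g) (f< , (g-monic , g<) , coprime) = f< , (g-monic , DegLt-suc g g<) , coprime
    exact⇒ : ∀ x → MonicCoprime k (λ f → DegLt f N₁) x → BoundedCoprime N₁ (suc k) x
    exact⇒ _ (f< , g-monic , coprime) = f< , (MonicOfDegree⇒Monic g-monic , MonicOfDegree.degree< g-monic) , coprime
    disjoint : ∀ x y → BoundedCoprime N₁ k x → MonicCoprime k (λ f → DegLt f N₁) y → ¬ x ≋₂ y
    disjoint _ _ (_ , (_ , g<) , _) (_ , monic top _ , _) (_ , g≋g′) =
      0≉1 (trans (sym (g< k ≤-refl)) (trans (coeff-≈ g≋g′ k) top))

  BoundedCoprime-without-[]-1ₚ⇔ν-Pair : ∀ N₁ N₂ x →
    (BoundedCoprime N₁ N₂ x × ¬ x ≋₂ ([] , 1ₚ)) ⇔ ν-Pair N₁ N₂ x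
  BoundedCoprime-without-[]-1ₚ⇔ν-Pair N₁ N₂ (f , g) = mk⇔
    (λ ((f< , (g-monic , g<) , coprime) , ≉[]-1ₚ) →
      (λ f≈0 → ≉[]-1ₚ (mk≋ f≈0 , Coprime-[]-monic _ (mk≋ {f} f≈0) coprime (Monic⇒MonicOfDegree g g-monic))) ,
      (λ g≈0 → 0≉1 (trans (sym (g≈0 _)) (MonicOfDegree.leading≈1 (Monic⇒MonicOfDegree g g-monic)))) ,
      coprime , g-monic , f< , g<)
    (λ (f≉0 , _ , coprime , g-monic , f< , g<) → (f< , (g-monic , g<) , coprime) , λ (f≋[] , _) → f≉0 (coeff-≈ f≋[]))

  count-ν-Pair : ∀ N₁ N₂ → 1 ≤ N₂ → N₂ ≤ N₁ →
    HasCount _≈₂_ (ν-Pair N₁ N₂) (q ^ (N₁ ℕ.+ N₂ ∸ 1) ∸ 1)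
  count-ν-Pair N₁ N₂ 1≤N₂ N₂≤N₁ =
    HasCount-⇔ (λ (f≋ , g≋) → coeff-≈ f≋ , coeff-≈ g≋) (λ (f≈ , g≈) → mk≋ f≈ , mk≋ g≈)
      (BoundedCoprime-without-[]-1ₚ⇔ν-Pair N₁ N₂)
      (HasCount-remove ≋₂-setoid
        (HasCount-resp-≡ (pairCount≡ N₁ N₂ 1≤N₂) (count-BoundedCoprime N₁ N₂ N₂≤N₁))
        ([] , 1ₚ) ((λ _ _ → refl) , (MonicOfDegree⇒Monic 1ₚ-monic , 1ₚ<N₂) , Coprime-1ₚ [] ≋-refl))
    where
    1ₚ<N₂ : DegLt 1ₚ N₂
    1ₚ<N₂ zero    N₂≤0 with () ← ≤-trans 1≤N₂ N₂≤0
    1ₚ<N₂ (suc l) _    = refl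

open import Data.Nat using (ℕ; zero; suc; _≤_; _+_; _∸_; _^_)
open import Data.Product using (proj₁)

lemma3p3 : ∀ {c ℓ} (q : ℕ) → IsPrimePower q → (F : Field c ℓ) → HasCard F q →
           (N₁ N₂ : ℕ) → 1 ≤ N₁ → 1 ≤ N₂ → N₂ ≤ N₁ →
           HasCount (Poly._≈₂_ F) (Poly.ν-Pair F N₁ N₂) (q ^ (N₁ + N₂ ∸ 1) ∸ 1)
lemma3p3 zero    _ F card _  _  _ _    _     with () ← proj₁ (HasCard.enum-surj card (Field.0# F))
lemma3p3 (suc p) _ F card N₁ N₂ _ 1≤N₂ N₂≤N₁ = CoprimePairCount.count-ν-Pair F p card N₁ N₂ 1≤N₂ N₂≤N₁
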